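{- Let $k\geq2$ and $r<\frac{(k-1)n}{k}$ be positive integers and let $\mathcal{F}\subseteq\binom{[n]}{r}$ be $k$-wise intersecting. Let $\sigma=(\sigma(1),\dots,\sigma(n))$ be a permutation of $[n]$ (viewed as a cyclic order) and $v\in[n]$ a position such that $\sigma$ is saturated and every set of $\mathcal{F}_\sigma$ contains $\sigma(v)$. Let $i\in[n]\setminus\{v,v-1\}$ (where $v-1=n$ if $v=1$), and let $\mu$ be obtained from $\sigma$ by swapping the entries in positions $i$ and $i+1$ (where $i+1=1$ if $i=n$). If $\mu$ is saturated, then every set of $\mathcal{F}_\mu$ contains $\mu(v)$ $(=\sigma(v))$.
   Context: $\binom{[n]}{r}$ is the family of $r$-subsets of $[n]=\{1,\dots,n\}$; $\mathcal{F}$ is $k$-wise intersecting if any $k$ members have a common element. A cyclic order on $[n]$ is a permutation $\sigma$ written as a sequence $(\sigma(1),\dots,\sigma(n))$, positions taken mod $n$. A $\sigma$-interval of length $r$ is a set $\{\sigma(x),\sigma(x+1),\dots,\sigma(x+r-1)\}$ (indices mod $n$). $\mathcal{F}_\sigma$ denotes the set of members of $\mathcal{F}$ that are $\sigma$-intervals. $\sigma$ is called saturated if $|\mathcal{F}_\sigma|=r$. -}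

module Defs where

open import Data.Nat using (ℕ; zero; suc; _+_; NonZero)
open import Data.Nat.DivMod using (_mod_)
open import Data.Fin using (Fin; toℕ)
open import Data.Fin.Subset using (Subset; ⊥; ⁅_⁆; _∪_; _∈_; ∣_∣)
open import Data.Fin.Permutation using (Permutation′; _⟨$⟩ʳ_; transpose; _∘ₚ_)
open import Data.Fin.Properties using (any?)
open import Data.Bool using (Bool)
import Data.Bool.Properties as BoolP
open import Data.Vec.Properties using (≡-dec)
open import Data.List using (List; filter; length)
open import Data.List.Membership.Propositional using () renaming (_∈_ to _∈ₗ_)
open import Data.Product using (∃; ∃-syntax; Σ-syntax)
open import Relation.Binary.PropositionalEquality using (_≡_)
open import Relation.Nullary using (Dec)

-- Positions in the cyclic order are Fin n = {0,…,n-1} (paper: 1..n), taken mod n.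
pos : {n : ℕ} .{{_ : NonZero n}} → ℕ → Fin n
pos {n} m = m mod n

next : {n : ℕ} .{{_ : NonZero n}} → Fin n → Fin n
next i = pos (suc (toℕ i))

interval : {n : ℕ} .{{_ : NonZero n}} → Permutation′ n → Fin n → ℕ → Subset n
interval σ x zero = ⊥
interval σ x (suc j) = ⁅ σ ⟨$⟩ʳ pos (toℕ x + j) ⁆ ∪ interval σ x j

IsInterval : {n : ℕ} .{{_ : NonZero n}} → Permutation′ n → ℕ → Subset n → Set
IsInterval σ r A = ∃[ x ] interval σ x r ≡ A

isInterval? : {n : ℕ} .{{_ : NonZero n}} (σ : Permutation′ n) (r : ℕ) (A : Subset n) →
              Dec (IsInterval σ r A)
isInterval? σ r A = any? (λ x → ≡-dec BoolP._≟_ (interval σ x r) A)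

-- A family is a list of distinct r-subsets of Fin n.
-- F_σ: members of F that are σ-intervals (of length r).
Fσ : {n : ℕ} .{{_ : NonZero n}} → Permutation′ n → ℕ → List (Subset n) → List (Subset n)
Fσ σ r F = filter (isInterval? σ r) F

Saturated : {n : ℕ} .{{_ : NonZero n}} → Permutation′ n → ℕ → List (Subset n) → Set
Saturated σ r F = length (Fσ σ r F) ≡ r

-- k-wise intersecting: any k members (repetition allowed) have a common element
KWiseIntersecting : {n : ℕ} → ℕ → List (Subset n) → Set
KWiseIntersecting {n} k F =
  (G : Fin k → Subset n) → (∀ j → G j ∈ₗ F) → ∃[ x ] (∀ j → x ∈ G j)

AllContain : {n : ℕ} .{{_ : NonZero n}} → Permutation′ n → ℕ → List (Subset n) → Fin n → Set
AllContain σ r F v = ∀ A → A ∈ₗ F → IsInterval σ r A → (σ ⟨$⟩ʳ v) ∈ A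

-- Measure positions by their offset from v, and let d = n − r.  The σ-intervals containing σ(v) are
-- the r intervals star b (1 ≤ b ≤ r) starting at offset b + d, so by saturation F contains all of them.
-- A μ-interval avoiding σ(v) never reaches offset 0, and the transposition moves at most one of its
-- elements by one step, so its σ-offsets lie in a window [lo, lo + r] with lo ≥ 1.  Since star b misses
-- the offsets [b, b + d) and r < (k − 1) d, some k − 1 stars jointly miss that window: together with the
-- μ-interval they are k members of F without a common element.
module Submission where

open import Defs
open import Data.Nat
  using (ℕ; zero; suc; _+_; _*_; _∸_; _≤_; _<_; _⊓_; z≤n; s≤s; s≤s⁻¹; NonZero; _≟_; _<?_; _≤?_)
open import Data.Nat.Properties
open import Data.Nat.DivMod using (_%_; m%n<n; m<n⇒m%n≡m; %-distribˡ-+; m%n%n≡m%n; [m+n]%n≡m%n)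
open import Data.Fin using (Fin; zero; suc; toℕ; fromℕ<)
import Data.Fin.Properties as Fin
open import Data.Fin.Subset using (Subset; ∣_∣; _∈_; _∉_; ⁅_⁆; _∪_)
open import Data.Fin.Subset.Properties
  using (_∈?_; ∉⊥; x∈⁅x⁆; x∈⁅y⁆⇒x≡y; x∈p∪q⁻; p⊆p∪q; q⊆p∪q)
open import Data.Fin.Permutation using (Permutation′; _⟨$⟩ʳ_; transpose; _∘ₚ_)
open import Function.Bundles using (Injection)
open import Function.Properties.Inverse using (↔⇒↣)
open import Data.Vec.Properties using (≡-dec)
import Data.Bool as Bool
import Data.Fin.Permutation.Components as PC
open import Data.List using (List; []; _∷_; length; applyUpTo)
open import Data.List.Properties using (length-removeAt′; length-applyUpTo)
open import Data.List.Membership.Propositional.Properties using (∈-applyUpTo⁺; ∈-filter⁻)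
open import Data.List.Relation.Unary.Unique.Propositional.Properties using (filter⁺)
open import Data.List.Relation.Unary.Any using (here; there; index; _─_)
import Data.List.Relation.Unary.All as All
open import Data.List.Relation.Unary.AllPairs using (_∷_)
open import Data.List.Relation.Binary.Subset.Propositional using (_⊆_)
import Data.List.Membership.DecPropositional as DecMembership
open import Data.List.Membership.Propositional using () renaming (_∈_ to _∈ₗ_; _∉_ to _∉ₗ_)
open import Data.List.Relation.Unary.Unique.Propositional using (Unique)
open import Data.Product using (∃-syntax; _×_; _,_; proj₁)
open import Data.Sum using (_⊎_; inj₁; inj₂)
open import Data.Empty using (⊥-elim)
open import Relation.Binary.PropositionalEquality
open import Relation.Binary.Definitions using (DecidableEquality)
open import Relation.Nullary using (¬_; yes; no; contradiction)
open import Relation.Nullary.Decidable using (decidable-stable)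
open import Function using (_∘_)

-- e is t with c and suc c exchanged; `fixed` is allowed for every t, which only weakens the relation.
data Swapped (c t : ℕ) : ℕ → Set where
  swap-c   : t ≡ c → Swapped c t (suc c)
  swap-suc : t ≡ suc c → Swapped c t c
  fixed    : Swapped c t t

swapped-< : ∀ {n c t e} → suc c < n → t < n → Swapped c t e → e < n
swapped-< c+1<n _ (swap-c _) = c+1<n
swapped-< c+1<n _ (swap-suc _) = <-trans (n<1+n _) c+1<n
swapped-< _ t<n fixed = t<n

swapped-window : ∀ {a c} r → 1 ≤ a → 1 ≤ c →
                 ∃[ lo ] 1 ≤ lo × (∀ {j e} → j < r → Swapped c (a + j) e → lo ≤ e × e ≤ lo + r)
swapped-window {a} {c} r 1≤a 1≤c with suc c ≟ a
... | yes refl = c , 1≤c , below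
  where
  below : ∀ {j e} → j < r → Swapped c (suc c + j) e → c ≤ e × e ≤ c + r
  below {j} _ (swap-c c+1+j≡c) = contradiction (sym c+1+j≡c) (<⇒≢ (s≤s (m≤m+n c j)))
  below _ (swap-suc _) = ≤-refl , m≤m+n c _
  below {j} j<r fixed = ≤-trans (n≤1+n c) (m≤m+n (suc c) j) , subst (_≤ c + r) (+-suc c j) (+-monoʳ-≤ c j<r)
... | no c+1≢a = a , 1≤a , around
  where
  around : ∀ {j e} → j < r → Swapped c (a + j) e → a ≤ e × e ≤ a + r
  around {j} j<r (swap-c a+j≡c) =
    ≤-trans (m≤m+n a j) (≤-trans (≤-reflexive a+j≡c) (n≤1+n c)) ,
    subst (_≤ a + r) (trans (+-suc a j) (cong suc a+j≡c)) (+-monoʳ-≤ a j<r)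
  around {zero} _ (swap-suc a+0≡c+1) = contradiction (sym (trans (sym (+-identityʳ a)) a+0≡c+1)) c+1≢a
  around {suc j} j<r (swap-suc a+j+1≡c+1) =
    subst (a ≤_) a+j≡c (m≤m+n a j) , subst (_≤ a + r) a+j≡c (+-monoʳ-≤ a (<⇒≤ (<-trans (n<1+n j) j<r)))
    where a+j≡c = suc-injective (trans (sym (+-suc a j)) a+j+1≡c+1)
  around {j} j<r fixed = m≤m+n a j , +-monoʳ-≤ a (<⇒≤ j<r)

first-window : ∀ d K {lo e} → lo ≤ e → e < lo + K * d →
               ∃[ m ] m < K × lo + m * d ≤ e × e < lo + m * d + d
first-window d zero {lo} lo≤e e<lo = contradiction (subst (_ <_) (+-identityʳ lo) e<lo) (≤⇒≯ lo≤e)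
first-window d (suc K) {lo} {e} lo≤e e<lo+[1+K]d with e <? lo + K * d
... | yes e<lo+Kd with first-window d K lo≤e e<lo+Kd
...   | m , m<K , window = m , m<n⇒m<1+n m<K , window
first-window d (suc K) {lo} {e} lo≤e e<lo+[1+K]d | no e≮lo+Kd =
  K , ≤-refl , ≮⇒≥ e≮lo+Kd , subst (e <_) lo+[1+K]d≡ e<lo+[1+K]d
  where
  lo+[1+K]d≡ : lo + (d + K * d) ≡ lo + K * d + d
  lo+[1+K]d≡ = trans (cong (lo +_) (+-comm d (K * d))) (sym (+-assoc lo (K * d) d))

window-starts-cover : ∀ {d r} K {lo e} → lo ≤ e → e ≤ lo + r → e < r + d → r < K * d →
                      ∃[ m ] m < K × (lo + m * d) ⊓ r ≤ e × e < (lo + m * d) ⊓ r + d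
window-starts-cover {d} {r} K {lo} {e} lo≤e e≤lo+r e<r+d r<Kd
  with first-window d K lo≤e (≤-<-trans e≤lo+r (+-monoʳ-< lo r<Kd))
... | m , m<K , b≤e , e<b+d with lo + m * d ≤? r
...   | yes b≤r = m , m<K , subst (_≤ e) (sym b⊓r≡b) b≤e , subst (λ z → e < z + d) (sym b⊓r≡b) e<b+d
  where b⊓r≡b = m≤n⇒m⊓n≡m b≤r
...   | no b≰r = m , m<K , subst (_≤ e) (sym b⊓r≡r) (≤-trans (<⇒≤ (≰⇒> b≰r)) b≤e) ,
                 subst (λ z → e < z + d) (sym b⊓r≡r) e<r+d
  where b⊓r≡r = m≥n⇒m⊓n≡n (<⇒≤ (≰⇒> b≰r))

wrap-below : ∀ {w b d j r} → w + (r + d) ≡ b + d + j → j < r → w < b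
wrap-below {w} {b} {d} {j} {r} eq j<r = +-cancelʳ-< r w b (begin-strict
  w + r   ≡⟨ +-cancelʳ-≡ d (w + r) (b + j) (begin-equality
               w + r + d    ≡⟨ +-assoc w r d ⟩
               w + (r + d)  ≡⟨ eq ⟩
               b + d + j    ≡⟨ +-assoc b d j ⟩
               b + (d + j)  ≡⟨ cong (b +_) (+-comm d j) ⟩
               b + (j + d)  ≡⟨ +-assoc b j d ⟨
               b + j + d    ∎) ⟩
  b + j   <⟨ +-monoʳ-< b j<r ⟩
  b + r   ∎)
  where open ≤-Reasoning

[1+K]r<Kn⇒r<K[n∸r] : ∀ {K r n} → suc K * r < K * n → ∃[ d ] n ≡ r + d × r < K * d
[1+K]r<Kn⇒r<K[n∸r] {K} {r} {n} [1+K]r<Kn =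
  n ∸ r , sym (m+[n∸m]≡n r≤n) , +-cancelˡ-< (K * r) r (K * (n ∸ r)) (begin-strict
  K * r + r            ≡⟨ +-comm (K * r) r ⟩
  suc K * r            <⟨ [1+K]r<Kn ⟩
  K * n                ≡⟨ cong (K *_) (m+[n∸m]≡n r≤n) ⟨
  K * (r + (n ∸ r))    ≡⟨ *-distribˡ-+ K r (n ∸ r) ⟩
  K * r + K * (n ∸ r)  ∎)
  where
  open ≤-Reasoning
  r≤n : r ≤ n
  r≤n = ≮⇒≥ λ n<r → <⇒≱ [1+K]r<Kn (≤-trans (*-monoʳ-≤ K (<⇒≤ n<r)) (m≤n+m (K * r) r))

module _ {A : Set} where

  ∈-─⁺ : ∀ {x y} {xs : List A} (x∈xs : x ∈ₗ xs) → y ∈ₗ xs → y ≢ x → y ∈ₗ (xs ─ x∈xs)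
  ∈-─⁺ (here refl) (here refl) y≢x = contradiction refl y≢x
  ∈-─⁺ (here refl) (there y∈xs) _ = y∈xs
  ∈-─⁺ (there _) (here refl) _ = here refl
  ∈-─⁺ (there x∈xs) (there y∈xs) y≢x = there (∈-─⁺ x∈xs y∈xs y≢x)

  unique-⊆⇒length≤ : ∀ {xs ys : List A} → Unique xs → xs ⊆ ys → length xs ≤ length ys
  unique-⊆⇒length≤ {[]} _ _ = z≤n
  unique-⊆⇒length≤ {x ∷ xs} {ys} (x∉xs ∷ xs!) xs⊆ys = begin
    suc (length xs)            ≤⟨ s≤s (unique-⊆⇒length≤ xs! xs⊆ys─x) ⟩
    suc (length (ys ─ x∈ys))   ≡⟨ length-removeAt′ ys (index x∈ys) ⟨
    length ys                  ∎
    where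
    open ≤-Reasoning
    x∈ys = xs⊆ys (here refl)
    xs⊆ys─x : xs ⊆ (ys ─ x∈ys)
    xs⊆ys─x y∈xs = ∈-─⁺ x∈ys (xs⊆ys (there y∈xs)) (λ y≡x → All.lookup x∉xs y∈xs (sym y≡x))

  unique-⊆-length≥⇒⊇ : DecidableEquality A → ∀ {xs ys : List A} →
                        Unique xs → xs ⊆ ys → length ys ≤ length xs → ys ⊆ xs
  unique-⊆-length≥⇒⊇ eq? {xs} {ys} xs! xs⊆ys ys≤xs {y} y∈ys with DecMembership._∈?_ eq? y xs
  ... | yes y∈xs = y∈xs
  ... | no y∉xs = contradiction (unique-⊆⇒length≤ xs! xs⊆ys─y) (<⇒≱ (begin-strict
    length (ys ─ y∈ys)        <⟨ n<1+n _ ⟩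
    suc (length (ys ─ y∈ys))  ≡⟨ length-removeAt′ ys (index y∈ys) ⟨
    length ys                 ≤⟨ ys≤xs ⟩
    length xs                 ∎))
    where
    open ≤-Reasoning
    xs⊆ys─y : xs ⊆ (ys ─ y∈ys)
    xs⊆ys─y z∈xs = ∈-─⁺ y∈ys (xs⊆ys z∈xs) (λ z≡y → y∉xs (subst (_∈ₗ xs) z≡y z∈xs))

⟨$⟩ʳ-injective : ∀ {n} (π : Permutation′ n) {p q} → π ⟨$⟩ʳ p ≡ π ⟨$⟩ʳ q → p ≡ q
⟨$⟩ʳ-injective π = Injection.injective (↔⇒↣ π)

transpose-fixes : ∀ {m} {i j k : Fin m} → k ≢ i → k ≢ j → PC.transpose i j k ≡ k
transpose-fixes {i = i} {j} {k} k≢i k≢j with k Fin.≟ i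
... | yes k≡i = contradiction k≡i k≢i
... | no _ with k Fin.≟ j
...   | yes k≡j = contradiction k≡j k≢j
...   | no _ = refl

module _ {n : ℕ} .{{_ : NonZero n}} where

  toℕ-pos : ∀ m → toℕ (pos {n} m) ≡ m % n
  toℕ-pos m = Fin.toℕ-fromℕ< (m%n<n m n)

  pos-cong-% : ∀ {m m′} → m % n ≡ m′ % n → pos {n} m ≡ pos m′
  pos-cong-% {m} {m′} eq = Fin.toℕ-injective (trans (toℕ-pos m) (trans eq (sym (toℕ-pos m′))))

  pos-toℕ : ∀ q → pos (toℕ q) ≡ q
  pos-toℕ q = Fin.toℕ-injective (trans (toℕ-pos (toℕ q)) (m<n⇒m%n≡m (Fin.toℕ<n q)))

  [m%n+j]%n≡[m+j]%n : ∀ m j → (m % n + j) % n ≡ (m + j) % n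
  [m%n+j]%n≡[m+j]%n m j = begin
    (m % n + j) % n           ≡⟨ %-distribˡ-+ (m % n) j n ⟩
    (m % n % n + j % n) % n   ≡⟨ cong (λ z → (z + j % n) % n) (m%n%n≡m%n m n) ⟩
    (m % n + j % n) % n       ≡⟨ %-distribˡ-+ m j n ⟨
    (m + j) % n               ∎
    where open ≡-Reasoning

  pos-+ : ∀ m j → pos {n} (toℕ (pos {n} m) + j) ≡ pos (m + j)
  pos-+ m j = pos-cong-% (trans (cong (λ z → (z + j) % n) (toℕ-pos m)) ([m%n+j]%n≡[m+j]%n m j))

  pos-+n : ∀ m → pos {n} (m + n) ≡ pos m
  pos-+n m = pos-cong-% ([m+n]%n≡m%n m n)

  module _ (π : Permutation′ n) (x : Fin n) where

    ∈-interval⁻ : ∀ m {y} → y ∈ interval π x m → ∃[ j ] j < m × y ≡ π ⟨$⟩ʳ pos (toℕ x + j)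
    ∈-interval⁻ zero y∈ = ⊥-elim (∉⊥ y∈)
    ∈-interval⁻ (suc m) y∈ with x∈p∪q⁻ ⁅ π ⟨$⟩ʳ pos (toℕ x + m) ⁆ (interval π x m) y∈
    ... | inj₁ y∈⁅⁆ = m , ≤-refl , x∈⁅y⁆⇒x≡y _ y∈⁅⁆
    ... | inj₂ y∈I with ∈-interval⁻ m y∈I
    ...   | j , j<m , y≡ = j , m<n⇒m<1+n j<m , y≡

    ∈-interval⁺ : ∀ {m j} → j < m → π ⟨$⟩ʳ pos (toℕ x + j) ∈ interval π x m
    ∈-interval⁺ {suc m} {j} j<1+m with m≤n⇒m<n∨m≡n (s≤s⁻¹ j<1+m)
    ... | inj₁ j<m = q⊆p∪q ⁅ π ⟨$⟩ʳ pos (toℕ x + m) ⁆ (interval π x m) (∈-interval⁺ j<m)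
    ... | inj₂ refl = p⊆p∪q (interval π x m) (x∈⁅x⁆ _)

module Offsets {n : ℕ} .{{_ : NonZero n}} (v : Fin n) where

  off : ℕ → Fin n
  off t = pos (toℕ v + t)

  off-zero : off 0 ≡ v
  off-zero = trans (cong pos (+-identityʳ (toℕ v))) (pos-toℕ v)

  off-+n : ∀ t → off (t + n) ≡ off t
  off-+n t = trans (cong pos (sym (+-assoc (toℕ v) t n))) (pos-+n (toℕ v + t))

  off-shift : ∀ t j → pos (toℕ (off t) + j) ≡ off (t + j)
  off-shift t j = trans (pos-+ (toℕ v + t) j) (cong pos (+-assoc (toℕ v) t j))

  offset : Fin n → ℕ
  offset q = (toℕ q + (n ∸ toℕ v)) % n

  offset<n : ∀ q → offset q < n
  offset<n q = m%n<n _ n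

  private
    v+[n∸v] : ∀ x → toℕ v + x + (n ∸ toℕ v) ≡ x + n
    v+[n∸v] x = begin
      toℕ v + x + (n ∸ toℕ v)   ≡⟨ cong (_+ (n ∸ toℕ v)) (+-comm (toℕ v) x) ⟩
      x + toℕ v + (n ∸ toℕ v)   ≡⟨ +-assoc x (toℕ v) (n ∸ toℕ v) ⟩
      x + (toℕ v + (n ∸ toℕ v)) ≡⟨ cong (x +_) (m+[n∸m]≡n (<⇒≤ (Fin.toℕ<n v))) ⟩
      x + n                     ∎
      where open ≡-Reasoning

  offset-off : ∀ t → offset (off t) ≡ t % n
  offset-off t = begin
    (toℕ (off t) + (n ∸ toℕ v)) % n      ≡⟨ cong (λ z → (z + (n ∸ toℕ v)) % n) (toℕ-pos (toℕ v + t)) ⟩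
    ((toℕ v + t) % n + (n ∸ toℕ v)) % n  ≡⟨ [m%n+j]%n≡[m+j]%n (toℕ v + t) (n ∸ toℕ v) ⟩
    (toℕ v + t + (n ∸ toℕ v)) % n        ≡⟨ cong (_% n) (v+[n∸v] t) ⟩
    (t + n) % n                          ≡⟨ [m+n]%n≡m%n t n ⟩
    t % n                                ∎
    where open ≡-Reasoning

  off-offset : ∀ q → off (offset q) ≡ q
  off-offset q = trans (pos-cong-% (begin
    (toℕ v + X % n) % n  ≡⟨ cong (_% n) (+-comm (toℕ v) (X % n)) ⟩
    (X % n + toℕ v) % n  ≡⟨ [m%n+j]%n≡[m+j]%n X (toℕ v) ⟩
    (X + toℕ v) % n      ≡⟨ cong (_% n) (+-comm X (toℕ v)) ⟩
    (toℕ v + X) % n      ≡⟨ cong (_% n) (sym (+-assoc (toℕ v) (toℕ q) (n ∸ toℕ v))) ⟩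
    (toℕ v + toℕ q + (n ∸ toℕ v)) % n ≡⟨ cong (_% n) (v+[n∸v] (toℕ q)) ⟩
    (toℕ q + n) % n      ∎)) (trans (pos-+n (toℕ q)) (pos-toℕ q))
    where
    X = toℕ q + (n ∸ toℕ v)
    open ≡-Reasoning

  off-injective : ∀ {s t} → s < n → t < n → off s ≡ off t → s ≡ t
  off-injective {s} {t} s<n t<n eq = begin
    s               ≡⟨ m<n⇒m%n≡m s<n ⟨
    s % n           ≡⟨ offset-off s ⟨
    offset (off s)  ≡⟨ cong offset eq ⟩
    offset (off t)  ≡⟨ offset-off t ⟩
    t % n           ≡⟨ m<n⇒m%n≡m t<n ⟩
    t               ∎
    where open ≡-Reasoning

  ∈-interval-off⁻ : ∀ π s m {y} → y ∈ interval π (off s) m → ∃[ j ] j < m × y ≡ π ⟨$⟩ʳ off (s + j)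
  ∈-interval-off⁻ π s m y∈ with ∈-interval⁻ π (off s) m y∈
  ... | j , j<m , y≡ = j , j<m , trans y≡ (cong (π ⟨$⟩ʳ_) (off-shift s j))

  ∈-interval-off⁺ : ∀ π s {m j} → j < m → π ⟨$⟩ʳ off (s + j) ∈ interval π (off s) m
  ∈-interval-off⁺ π s {m} {j} j<m =
    subst (λ q → π ⟨$⟩ʳ q ∈ interval π (off s) m) (off-shift s j) (∈-interval⁺ π (off s) j<m)

  off-<2n : ∀ {u} → u < n + n → ∃[ w ] w < n × off u ≡ off w × (u ≡ w ⊎ u ≡ w + n)
  off-<2n {u} u<2n with u <? n
  ... | yes u<n = u , u<n , refl , inj₁ refl
  ... | no u≮n = u ∸ n , +-cancelʳ-< n (u ∸ n) n (subst (_< n + n) u≡w+n u<2n) ,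
                 trans (cong off u≡w+n) (off-+n (u ∸ n)) , inj₂ u≡w+n
    where u≡w+n = sym (m∸n+n≡m (≮⇒≥ u≮n))

  WithinOffsets : Permutation′ n → ℕ → ℕ → Subset n → Set
  WithinOffsets π lo len A =
    ∀ {y} → y ∈ A → ∃[ e ] lo ≤ e × e ≤ lo + len × e < n × y ≡ π ⟨$⟩ʳ off e

  transpose-off : ∀ {c t} → suc c < n → t < n →
                  ∃[ e ] Swapped c t e × PC.transpose (off c) (off (suc c)) (off t) ≡ off e
  transpose-off {c} {t} c+1<n t<n with off t Fin.≟ off c
  ... | yes eq = suc c , swap-c (off-injective t<n (<-trans (n<1+n c) c+1<n) eq) , refl
  ... | no _ with off t Fin.≟ off (suc c)
  ...   | yes eq = c , swap-suc (off-injective t<n c+1<n eq) , refl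
  ...   | no _ = t , fixed , refl

module Stars {n : ℕ} .{{_ : NonZero n}} (r d : ℕ) (n≡r+d : n ≡ r + d) (σ : Permutation′ n) (v : Fin n) where
  open Offsets v

  star : ℕ → Subset n
  star b = interval σ (off (b + d)) r

  r≤n : r ≤ n
  r≤n = subst (r ≤_) (sym n≡r+d) (m≤m+n r d)

  b+d≤n : ∀ {b} → b ≤ r → b + d ≤ n
  b+d≤n b≤r = subst (_ ≤_) (sym n≡r+d) (+-monoˡ-≤ d b≤r)

  star-offsets-∌ : ∀ {b e j} → b ≤ r → b ≤ e → e < b + d → j < r → off e ≢ off (b + d + j)
  star-offsets-∌ {b} {e} {j} b≤r b≤e e<b+d j<r off-e≡off-u
    with off-<2n (+-mono-≤-< (b+d≤n b≤r) (<-≤-trans j<r r≤n))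
  ... | w , w<n , off-u≡off-w , u≡w⊎w+n
    with off-injective (<-≤-trans e<b+d (b+d≤n b≤r)) w<n (trans off-e≡off-u off-u≡off-w)
  ...   | refl with u≡w⊎w+n
  ...     | inj₁ u≡e = <⇒≱ e<b+d (subst (b + d ≤_) u≡e (m≤m+n (b + d) j))
  ...     | inj₂ u≡e+n = <⇒≱ (wrap-below (trans (cong (e +_) (sym n≡r+d)) (sym u≡e+n)) j<r) b≤e

  star-∌ : ∀ {b e} → b ≤ r → b ≤ e → e < b + d → σ ⟨$⟩ʳ off e ∉ star b
  star-∌ b≤r b≤e e<b+d σe∈ with ∈-interval-off⁻ σ _ r σe∈
  ... | j , j<r , σe≡ = star-offsets-∌ b≤r b≤e e<b+d j<r (⟨$⟩ʳ-injective σ σe≡)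

  start-through-v : ∀ {s j} → s < n → j < r → off (s + j) ≡ v →
                    ∃[ b ] 1 ≤ b × b ≤ r × off s ≡ off (b + d)
  start-through-v {s} {j} s<n j<r off-u≡v with off-<2n (+-mono-< s<n (<-≤-trans j<r r≤n))
  ... | w , w<n , off-u≡off-w , u≡w⊎w+n
    with off-injective w<n (≤-<-trans z≤n s<n) (trans (sym off-u≡off-w) (trans off-u≡v (sym off-zero)))
  ...   | refl with u≡w⊎w+n
  ...     | inj₁ s+j≡0 = r , ≤-<-trans z≤n j<r , ≤-refl ,
                         trans (cong off (m+n≡0⇒m≡0 s s+j≡0)) (trans (sym (off-+n 0)) (cong off n≡r+d))
  ...     | inj₂ s+j≡n = r ∸ j , m<n⇒0<n∸m j<r , m∸n≤m r j , cong off (+-cancelʳ-≡ j s (r ∸ j + d) (begin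
    s + j            ≡⟨ trans s+j≡n n≡r+d ⟩
    r + d            ≡⟨ cong (_+ d) (m∸n+n≡m (<⇒≤ j<r)) ⟨
    r ∸ j + j + d    ≡⟨ +-assoc (r ∸ j) j d ⟩
    r ∸ j + (j + d)  ≡⟨ cong (r ∸ j +_) (+-comm j d) ⟩
    r ∸ j + (d + j)  ≡⟨ +-assoc (r ∸ j) d j ⟨
    r ∸ j + d + j    ∎))
    where open ≡-Reasoning

  interval∋v⇒star : ∀ {x} → σ ⟨$⟩ʳ v ∈ interval σ x r →
                    ∃[ b ] 1 ≤ b × b ≤ r × interval σ x r ≡ star b
  interval∋v⇒star {x} σv∈
    with ∈-interval-off⁻ σ (offset x) r
           (subst (λ q → σ ⟨$⟩ʳ v ∈ interval σ q r) (sym (off-offset x)) σv∈)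
  ... | j , j<r , σv≡ with start-through-v (offset<n x) j<r (sym (⟨$⟩ʳ-injective σ σv≡))
  ...   | b , 1≤b , b≤r , off-s≡ =
    b , 1≤b , b≤r , cong (λ q → interval σ q r) (trans (sym (off-offset x)) off-s≡)

  module _ (F : List (Subset n)) (F! : Unique F) (saturated : Saturated σ r F)
           (all∋σv : AllContain σ r F v) where

    stars : List (Subset n)
    stars = applyUpTo (λ b → star (suc b)) r

    star∈stars : ∀ {b} → 1 ≤ b → b ≤ r → star b ∈ₗ stars
    star∈stars {suc b} _ b<r = ∈-applyUpTo⁺ (λ b → star (suc b)) {i = b} b<r

    interval∋v⇒∈stars : ∀ {x} → σ ⟨$⟩ʳ v ∈ interval σ x r → interval σ x r ∈ₗ stars
    interval∋v⇒∈stars σv∈ =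
      let (b , 1≤b , b≤r , I≡star) = interval∋v⇒star σv∈
      in subst (_∈ₗ stars) (sym I≡star) (star∈stars 1≤b b≤r)

    Fσ⊆stars : Fσ σ r F ⊆ stars
    Fσ⊆stars {A} A∈Fσ =
      let (A∈F , x , I≡A) = ∈-filter⁻ (isInterval? σ r) A∈Fσ
      in  subst (_∈ₗ stars) I≡A
            (interval∋v⇒∈stars (subst (σ ⟨$⟩ʳ v ∈_) (sym I≡A) (all∋σv A A∈F (x , I≡A))))

    -- Pigeonhole: F_σ has no repetitions, F_σ ⊆ stars, and both lists have length r.
    star∈F : ∀ {b} → 1 ≤ b → b ≤ r → star b ∈ₗ F
    star∈F 1≤b b≤r = proj₁ (∈-filter⁻ (isInterval? σ r)
      (unique-⊆-length≥⇒⊇ (≡-dec Bool._≟_) (filter⁺ (isInterval? σ r) F!) Fσ⊆stars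
        (≤-reflexive (trans (length-applyUpTo _ r) (sym saturated))) (star∈stars 1≤b b≤r)))

    window-start : ℕ → ℕ → ℕ
    window-start lo m = (lo + m * d) ⊓ r

    window-family : ∀ K → ℕ → Subset n → Fin (suc K) → Subset n
    window-family K lo A zero = A
    window-family K lo A (suc m) = star (window-start lo (toℕ m))

    window∉F : ∀ {K lo A} → 1 ≤ r → r < K * d → KWiseIntersecting (suc K) F →
               1 ≤ lo → WithinOffsets σ lo r A → A ∉ₗ F
    window∉F {K} {lo} {A} 1≤r r<Kd k-wise 1≤lo A-within A∈F =
      let (y , y∈family) = k-wise (window-family K lo A) family∈F
          (e , lo≤e , e≤lo+r , e<n , y≡σe) = A-within (y∈family zero)
          (m , m<K , b≤e , e<b+d) = window-starts-cover K lo≤e e≤lo+r (subst (e <_) n≡r+d e<n) r<Kd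
          y∈star = subst (λ m′ → y ∈ star (window-start lo m′)) (Fin.toℕ-fromℕ< m<K)
                         (y∈family (suc (fromℕ< m<K)))
      in star-∌ (m⊓n≤n _ r) b≤e e<b+d (subst (_∈ star (window-start lo m)) y≡σe y∈star)
      where
      family∈F : ∀ m → window-family K lo A m ∈ₗ F
      family∈F zero = A∈F
      family∈F (suc m) = star∈F (⊓-glb (≤-trans 1≤lo (m≤m+n lo _)) 1≤r) (m⊓n≤n _ r)

module Transposition {n : ℕ} .{{_ : NonZero n}} (σ : Permutation′ n) (v i : Fin n)
                     (i≢v : i ≢ v) (next-i≢v : next i ≢ v) where
  open Offsets v

  μ : Permutation′ n
  μ = transpose i (next i) ∘ₚ σ

  μ-v : μ ⟨$⟩ʳ v ≡ σ ⟨$⟩ʳ v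
  μ-v = cong (σ ⟨$⟩ʳ_) (transpose-fixes (≢-sym i≢v) (≢-sym next-i≢v))

  c : ℕ
  c = offset i

  off-1+c : off (suc c) ≡ next i
  off-1+c = begin
    off (suc c)            ≡⟨ cong off (+-comm 1 c) ⟩
    off (c + 1)            ≡⟨ off-shift c 1 ⟨
    pos (toℕ (off c) + 1)  ≡⟨ cong (λ q → pos (toℕ q + 1)) (off-offset i) ⟩
    pos (toℕ i + 1)        ≡⟨ cong pos (+-comm (toℕ i) 1) ⟩
    next i                 ∎
    where open ≡-Reasoning

  1≤c : 1 ≤ c
  1≤c = n≢0⇒n>0 (λ c≡0 → i≢v (trans (sym (off-offset i)) (trans (cong off c≡0) off-zero)))

  1+c<n : suc c < n
  1+c<n = ≤∧≢⇒< (offset<n i) (λ 1+c≡n →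
    next-i≢v (trans (sym off-1+c) (trans (cong off 1+c≡n) (trans (off-+n 0) off-zero))))

  μ-off : ∀ {t} → t < n → ∃[ e ] Swapped c t e × μ ⟨$⟩ʳ off t ≡ σ ⟨$⟩ʳ off e
  μ-off {t} t<n =
    let (e , swapped , transposed) = transpose-off 1+c<n t<n
    in  e , swapped ,
        cong (σ ⟨$⟩ʳ_) (subst₂ (λ p q → PC.transpose p q (off t) ≡ off e) (off-offset i) off-1+c transposed)

  module _ {r a} (1≤r : 1 ≤ r) (a<n : a < n) (σv∉ : σ ⟨$⟩ʳ v ∉ interval μ (off a) r) where

    misses-v : ∀ {j} → j < r → off (a + j) ≢ v
    misses-v j<r off≡v =
      σv∉ (subst (_∈ interval μ (off a) r) (trans (cong (μ ⟨$⟩ʳ_) off≡v) μ-v) (∈-interval-off⁺ μ a j<r))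

    1≤a : 1 ≤ a
    1≤a = n≢0⇒n>0 (λ a≡0 → misses-v 1≤r (trans (cong off (trans (+-identityʳ a) a≡0)) off-zero))

    a+r≤n : a + r ≤ n
    a+r≤n = ≮⇒≥ λ n<a+r →
      let a+t≡n = m+[n∸m]≡n (<⇒≤ a<n)
      in  misses-v (+-cancelˡ-< a (n ∸ a) r (subst (_< a + r) (sym a+t≡n) n<a+r))
                   (trans (cong off a+t≡n) (trans (off-+n 0) off-zero))

    avoiding-v⇒window : ∃[ lo ] 1 ≤ lo × WithinOffsets σ lo r (interval μ (off a) r)
    avoiding-v⇒window =
      let (lo , 1≤lo , bounds) = swapped-window r 1≤a 1≤c
          within : WithinOffsets σ lo r (interval μ (off a) r)
          within y∈ =
            let (j , j<r , y≡) = ∈-interval-off⁻ μ a r y∈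
                a+j<n = <-≤-trans (+-monoʳ-< a j<r) a+r≤n
                (e , swapped , μ≡σ) = μ-off a+j<n
                (lo≤e , e≤lo+r) = bounds j<r swapped
            in  e , lo≤e , e≤lo+r , swapped-< 1+c<n a+j<n swapped , trans y≡ μ≡σ
      in  lo , 1≤lo , within

lemma2p3 : (n k r : ℕ) .{{_ : NonZero n}} → 2 ≤ k → 1 ≤ r → k * r < (k ∸ 1) * n →
    (F : List (Subset n)) → Unique F → (∀ A → A ∈ₗ F → ∣ A ∣ ≡ r) →
    KWiseIntersecting k F →
    (σ : Permutation′ n) (v : Fin n) → Saturated σ r F → AllContain σ r F v →
    (i : Fin n) → ¬ (i ≡ v) → ¬ (next i ≡ v) →
    Saturated (transpose i (next i) ∘ₚ σ) r F →
    AllContain (transpose i (next i) ∘ₚ σ) r F v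
lemma2p3 n zero r () _ _ _ _ _ _ _ _ _ _ _ _ _ _
lemma2p3 n (suc K) r _ 1≤r [1+K]r<Kn F F! _ k-wise σ v saturated all∋σv i i≢v next-i≢v _ A A∈F (x , I≡A) =
  subst (_∈ A) (sym μ-v) (decidable-stable (σ ⟨$⟩ʳ v ∈? A) λ σv∉A →
    let (d , n≡r+d , r<Kd) = [1+K]r<Kn⇒r<K[n∸r] {K} [1+K]r<Kn
        (lo , 1≤lo , within) = avoiding-v⇒window 1≤r (offset<n x) (σv∉A ∘ subst (σ ⟨$⟩ʳ v ∈_) I′≡A)
    in  Stars.window∉F r d n≡r+d σ v F F! saturated all∋σv {K} 1≤r r<Kd k-wise 1≤lo within
          (subst (_∈ₗ F) (sym I′≡A) A∈F))
  where
  open Offsets v using (off; offset; offset<n; off-offset)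
  open Transposition σ v i i≢v next-i≢v using (μ; μ-v; avoiding-v⇒window)
  I′≡A : interval μ (off (offset x)) r ≡ A
  I′≡A = trans (cong (λ q → interval μ q r) (off-offset x)) I≡A
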